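{- Let $\mathtt{At}$ be a countable set of atomic formulas and $\Phi_0$ the set of Boolean formulas over $\mathtt{At}$. The modal axiom schema $$\big(\neg\square\neg\phi\wedge B(\phi>\psi)\big)\rightarrow B(\phi\rightarrow\psi)\qquad(\phi,\psi\in\Phi_0)$$ corresponds to the following property of Kripke-Lewis frames $\langle S,\mathcal B,f\rangle$: $$(P\ast3)\qquad \forall s\in S,\ \forall E\in 2^S\setminus\{\varnothing\},\ \forall s'\in\mathcal B(s),\ \text{if } s'\in E \text{ then } s'\in\bigcup_{x\in\mathcal B(s)} f(x,E).$$ That is: (1) the schema is valid on every frame satisfying $(P\ast3)$, and (2) on every frame violating $(P\ast3)$ the schema is not valid.
   Context: $\Phi_0$ is built from $\mathtt{At}$ using $\neg$ and $\vee$ (with $\rightarrow,\wedge,\leftrightarrow$ defined as usual). A Kripke-Lewis frame is a triple $\langle S,\mathcal B,f\rangle$ where $S$ is a set of states, $\mathcal B\subseteq S\times S$ is a serial relation, $\mathcal B(s)=\{s':s\mathcal Bs'\}$, and $f:S\times(2^S\setminus\{\varnothing\})\to 2^S$ is an arbitrary function (no further properties assumed). A model is a frame together with a valuation $V:\mathtt{At}\to 2^S$. Truth at a state $s$: $s\models p$ iff $s\in V(p)$ for atoms; $\neg,\vee$ classical; $\Vert\phi\Vert=\{s:s\models\phi\}$. For $\phi\in\Phi_0$, $s\models\square\phi$ iff $\Vert\phi\Vert=S$. For $\phi,\psi\in\Phi_0$, $s\models\phi>\psi$ iff either $\Vert\phi\Vert=\varnothing$, or $\Vert\phi\Vert\neq\varnothing$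 and $f(s,\Vert\phi\Vert)\subseteq\Vert\psi\Vert$. For $\phi$ a Boolean combination of formulas of $\Phi_0$ and conditionals $\alpha>\beta$ ($\alpha,\beta\in\Phi_0$), $s\models B\phi$ iff $\mathcal B(s)\subseteq\Vert\phi\Vert$. A schema is valid on a frame if every instance is true at every state of every model based on that frame. -}

module Defs where

open import Data.Nat using (ℕ)
open import Data.Product using (Σ; ∃; _×_)
open import Data.Empty using (⊥)
open import Relation.Nullary using (¬_)
open import Level using (Level; suc; zero)

At : Set
At = ℕ

data Φ₀ : Set where
  atom : At → Φ₀
  ¬₀_  : Φ₀ → Φ₀
  _∨₀_ : Φ₀ → Φ₀ → Φ₀

infixr 6 _∨₀_
infix 7 ¬₀_

_→₀_ : Φ₀ → Φ₀ → Φ₀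
φ →₀ ψ = (¬₀ φ) ∨₀ ψ

data Ψ : Set where
  base  : Φ₀ → Ψ
  _>ᶜ_  : Φ₀ → Φ₀ → Ψ
  ¬ᵇ_   : Ψ → Ψ
  _∨ᵇ_  : Ψ → Ψ → Ψ

data L : Set where
  base : Φ₀ → L
  □_   : Φ₀ → L
  _>_  : Φ₀ → Φ₀ → L
  B_   : Ψ → L
  ¬ˡ_  : L → L
  _∨ˡ_ : L → L → L

infixr 5 _∨ˡ_
infix 7 ¬ˡ_

_∧ˡ_ : L → L → L
A ∧ˡ C = ¬ˡ ((¬ˡ A) ∨ˡ (¬ˡ C))

_→ˡ_ : L → L → L
A →ˡ C = (¬ˡ A) ∨ˡ C

infixr 4 _→ˡ_
infixr 6 _∧ˡ_

Subset : Set → Set₁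
Subset S = S → Set

-- Kripke-Lewis frame.  f is taken total on all subsets; its values on the
-- empty set are never used.
record Frame : Set₁ where
  field
    S      : Set
    Bel    : S → S → Set
    serial : (s : S) → ∃ (Bel s)
    f      : S → Subset S → Subset S

_or_ : Set → Set → Set
P or Q = ¬ (¬ P × ¬ Q)

module Semantics (F : Frame) (V : At → Subset (Frame.S F)) where
  open Frame F

  _⊨₀_ : S → Φ₀ → Set
  s ⊨₀ atom p  = V p s
  s ⊨₀ (¬₀ φ)  = ¬ (s ⊨₀ φ)
  s ⊨₀ (φ ∨₀ ψ) = (s ⊨₀ φ) or (s ⊨₀ ψ)

  ‖_‖ : Φ₀ → Subset S
  ‖ φ ‖ s = s ⊨₀ φ

  Empty : Subset S → Set
  Empty E = (y : S) → ¬ E y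

  NonEmpty : Subset S → Set
  NonEmpty E = Σ S E

  _⊆_ : Subset S → Subset S → Set
  E ⊆ G = (y : S) → E y → G y

  _⊨c_>_ : S → Φ₀ → Φ₀ → Set
  s ⊨c φ > ψ = Empty ‖ φ ‖ or (NonEmpty ‖ φ ‖ × (f s ‖ φ ‖ ⊆ ‖ ψ ‖))

  _⊨ᵇ_ : S → Ψ → Set
  s ⊨ᵇ base φ   = s ⊨₀ φ
  s ⊨ᵇ (φ >ᶜ ψ) = s ⊨c φ > ψ
  s ⊨ᵇ (¬ᵇ χ)   = ¬ (s ⊨ᵇ χ)
  s ⊨ᵇ (χ ∨ᵇ ξ) = (s ⊨ᵇ χ) or (s ⊨ᵇ ξ)

  _⊨_ : S → L → Set
  s ⊨ base φ   = s ⊨₀ φ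
  s ⊨ (□ φ)    = (y : S) → y ⊨₀ φ
  s ⊨ (φ > ψ)  = s ⊨c φ > ψ
  s ⊨ (B χ)    = (s' : S) → Bel s s' → s' ⊨ᵇ χ
  s ⊨ (¬ˡ A)   = ¬ (s ⊨ A)
  s ⊨ (A ∨ˡ C) = (s ⊨ A) or (s ⊨ C)

schema : Φ₀ → Φ₀ → L
schema φ ψ = ((¬ˡ (□ (¬₀ φ))) ∧ˡ (B (φ >ᶜ ψ))) →ˡ (B (base (φ →₀ ψ)))

SchemaValid : Frame → Set₁
SchemaValid F = (V : At → Subset (Frame.S F)) (s : Frame.S F) (φ ψ : Φ₀) →
  Semantics._⊨_ F V s (schema φ ψ)

-- (P*3): ∀ s, ∀ E ≠ ∅, ∀ s' ∈ 𝓑(s), s' ∈ E → s' ∈ ⋃_{x ∈ 𝓑(s)} f(x,E).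
-- (The non-emptiness of E is implied by s' ∈ E.)
P*3 : Frame → Set₁
P*3 F = (s : S) (E : Subset S) → Σ S E → (s' : S) → Bel s s' → E s' →
        Σ S (λ x → Bel s x × f x E s')
  where open Frame F

Violates-P*3 : Frame → Set₁
Violates-P*3 F = Σ S λ s → Σ (Subset S) λ E → Σ S λ s' →
  Bel s s' × E s' × ¬ (Σ S (λ x → Bel s x × f x E s'))
  where open Frame F

{-# OPTIONS --safe #-}
module Submission where

open import Defs
open import Data.Nat using (zero; suc)
open import Data.Product using (Σ; _×_; _,_; proj₂)
open import Function using (_∘_)
open import Relation.Nullary using (¬_)
open import Relation.Nullary.Negation using (¬¬-map)

-- (1) If s' ∈ 𝓑(s) satisfies φ, then ‖φ‖ ≠ ∅ and (P*3) yields x ∈ 𝓑(s) with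
-- s' ∈ f(x,‖φ‖); since x ⊨ φ > ψ, we get s' ⊨ ψ.
-- (2) Given s, E, s' violating (P*3), let p₀ be true on E and p₁ on
-- ⋃_{x ∈ 𝓑(s)} f(x,E).  Then ¬□¬p₀ and B(p₀ > p₁) hold at s, but s' ∈ 𝓑(s)
-- satisfies p₀ and not p₁, so B(p₀ → p₁) fails at s.

private
  variable
    P Q : Set

-- The truth conditions of →ˡ, ∧ˡ (and →₀) unfold to these; as `or` is the
-- ¬¬-rendering of ∨, their elimination rules hold only under ¬¬.
_implies_ : Set → Set → Set
P implies Q = (¬ P) or Q

_and_ : Set → Set → Set
P and Q = ¬ ((¬ P) or (¬ Q))

or-inj₂ : Q → P or Q
or-inj₂ q (_ , ¬q) = ¬q q

implies-intro : (P → ¬ ¬ Q) → P implies Q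
implies-intro p⇒¬¬q (¬¬p , ¬q) = ¬¬p λ p → p⇒¬¬q p ¬q

implies-elim : P implies Q → P → ¬ ¬ Q
implies-elim p⇒q p ¬q = p⇒q ((λ ¬p → ¬p p) , ¬q)

and-intro : P → Q → P and Q
and-intro p q ¬p∨¬q = ¬p∨¬q ((λ ¬p → ¬p p) , (λ ¬q → ¬q q))

and-elim : P and Q → ¬ ¬ (P × Q)
and-elim p∧q ¬p×q = p∧q λ (¬¬p , ¬¬q) → ¬¬p λ p → ¬¬q λ q → ¬p×q (p , q)

module _ (F : Frame) (V : At → Subset (Frame.S F)) where
  open Frame F
  open Semantics F V

  conditional-intro : ∀ {s φ ψ} → NonEmpty ‖ φ ‖ → f s ‖ φ ‖ ⊆ ‖ ψ ‖ →
                      s ⊨c φ > ψ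
  conditional-intro nonEmpty selected⊆ψ = or-inj₂ (nonEmpty , selected⊆ψ)

  conditional-elim : ∀ {s φ ψ} → s ⊨c φ > ψ → NonEmpty ‖ φ ‖ →
                     ¬ ¬ (f s ‖ φ ‖ ⊆ ‖ ψ ‖)
  conditional-elim s⊨φ>ψ (y , y⊨φ) ¬selected⊆ψ =
    s⊨φ>ψ ((λ empty → empty y y⊨φ) , λ (_ , selected⊆ψ) → ¬selected⊆ψ selected⊆ψ)

P*3⇒SchemaValid : (F : Frame) → P*3 F → SchemaValid F
P*3⇒SchemaValid F p*3 V s φ ψ =
  implies-intro λ premise → ¬¬-map (believed-implication ∘ proj₂) (and-elim premise)
  where
  open Frame F
  open Semantics F V

  believed-implication : s ⊨ (B (φ >ᶜ ψ)) → s ⊨ (B (base (φ →₀ ψ)))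
  believed-implication believed s' s𝓑s' = implies-intro λ s'⊨φ →
    let (x , s𝓑x , s'∈f[x,φ]) = p*3 s ‖ φ ‖ (s' , s'⊨φ) s' s𝓑s' s'⊨φ
    in ¬¬-map (λ f[x,φ]⊆ψ → f[x,φ]⊆ψ s' s'∈f[x,φ])
              (conditional-elim F V {φ = φ} {ψ} (believed x s𝓑x) (s' , s'⊨φ))

Violates-P*3⇒¬SchemaValid : (F : Frame) → Violates-P*3 F → ¬ SchemaValid F
Violates-P*3⇒¬SchemaValid F (s , E , s' , s𝓑s' , s'∈E , s'∉⋃f) valid =
  implies-elim (valid V s (atom 0) (atom 1)) (and-intro possible believed) refuted
  where
  open Frame F

  V : At → Subset S
  V zero    = E
  V (suc _) = λ y → Σ S λ x → Bel s x × f x E y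

  open Semantics F V

  possible : s ⊨ (¬ˡ (□ (¬₀ atom 0)))
  possible empty = empty s' s'∈E

  believed : s ⊨ (B (atom 0 >ᶜ atom 1))
  believed x s𝓑x = conditional-intro F V {φ = atom 0} {atom 1} (s' , s'∈E)
                      λ y y∈f[x,E] → x , s𝓑x , y∈f[x,E]

  refuted : ¬ (s ⊨ (B (base (atom 0 →₀ atom 1))))
  refuted believed-implication =
    implies-elim (believed-implication s' s𝓑s') s'∈E s'∉⋃f

proposition2 : (F : Frame) →
    (P*3 F → SchemaValid F) × (Violates-P*3 F → ¬ SchemaValid F)
proposition2 F = P*3⇒SchemaValid F , Violates-P*3⇒¬SchemaValid F
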